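{- Let $n\geq 3$ and $\vec{x}\in\mathbb{Z}^n$. If $k(\vec{x})<n$ and $\vec{x}(3)\leq\vec{x}(k(\vec{x})+1)$, then $f(\vec{x})=\vec{x}(k(\vec{x})+1)$.
   Context: For $\vec{x}\in\mathbb{Z}^n$ write $\vec{x}(i)$ for its $i$-th entry. $k(\vec{x})=n$ if $\vec{x}(1)>\cdots>\vec{x}(n)$, otherwise the least $k$ with $\vec{x}(k)\leq\vec{x}(k+1)$. $l(\vec{x})$ is the least $l$ with $1\leq l<k(\vec{x})$, $\vec{x}(l)>\vec{x}(l+1)+1$ and $\vec{x}(l+1)=\vec{x}(l+2)+1$ if it exists, otherwise $k(\vec{x})-1$. The function $f:\mathbb{Z}^n\to\mathbb{Z}$ (Bailey–Cowles) is given by: $f(\vec{x})=\vec{x}(1)$ if $k(\vec{x})=n$, and $f(\vec{x})=\max\{\vec{x}(l(\vec{x})+2),\vec{x}(k(\vec{x})+1)\}$ if $k(\vec{x})<n$. -}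

module Defs where

open import Data.Nat as ℕ using (ℕ; zero; suc; _∸_)
open import Data.Nat.Properties using (_<?_)
open import Data.Integer as ℤ using (ℤ; _≤?_; _≟_; _+_; +_) renaming (_<_ to _<ℤ_; _>_ to _>ℤ_)
import Data.Integer.Properties as ℤP
open import Data.Fin using (Fin; fromℕ<)
open import Data.Vec using (Vec; lookup)
open import Data.Bool using (Bool; true; false; _∧_; if_then_else_)
open import Relation.Nullary.Decidable using (⌊_⌋; yes; no)

-- 1-based entry access: ent x i = x(i) for 1 ≤ i ≤ n (value 0 outside that range,
-- which is never used by the definitions below).
ent : ∀ {n} → Vec ℤ n → ℕ → ℤ
ent {n} x zero = + 0
ent {n} x (suc i) with i <? n
... | yes p = lookup x (fromℕ< p)
... | no _  = + 0

-- k(x): n if x(1) > ... > x(n), else least k with x(k) ≤ x(k+1).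
-- kFrom x j searches k = j, j+1, ..., n-1 ; fuel bounds the search.
kFrom : ∀ {n} → Vec ℤ n → ℕ → ℕ → ℕ
kFrom {n} x j zero = n
kFrom {n} x j (suc fuel) with j <? n
... | no _ = n
... | yes _ with ent x j ≤? ent x (suc j)
...   | yes _ = j
...   | no _  = kFrom x (suc j) fuel

k : ∀ {n} → Vec ℤ n → ℕ
k {n} x = kFrom x 1 n

lCond : ∀ {n} → Vec ℤ n → ℕ → Bool
lCond x l = ⌊ (ent x (suc l) + + 1) ℤP.<? ent x l ⌋ ∧ ⌊ ent x (suc l) ≟ (ent x (suc (suc l)) + + 1) ⌋

lFrom : ∀ {n} → Vec ℤ n → ℕ → ℕ → ℕ → ℕ
lFrom x kk j zero = kk ∸ 1
lFrom x kk j (suc fuel) with j <? kk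
... | no _ = kk ∸ 1
... | yes _ = if lCond x j then j else lFrom x kk (suc j) fuel

l : ∀ {n} → Vec ℤ n → ℕ
l {n} x = lFrom x (k x) 1 n

f : ∀ {n} → Vec ℤ n → ℤ
f {n} x with k x <? n
... | no _  = ent x 1
... | yes _ = ent x (suc (suc (l x))) ℤ.⊔ ent x (suc (k x))

-- x(1) > ... > x(k) by definition of k, and l(x) + 2 is either k(x) + 1 or an index in
-- [3, k(x)]. In the latter case x(l + 2) ≤ x(3) ≤ x(k + 1) by monotonicity, so in either
-- case the maximum defining f(x) is attained by x(k + 1).
module Submission where

open import Defs
open import Data.Nat using (ℕ; suc; zero; _+_; _∸_; _≤_; _<_; _≤′_; ≤′-refl; ≤′-step; z≤n; s≤s)
open import Data.Nat.Properties
  using (_<?_; ≤-refl; ≤-reflexive; ≤-trans; <⇒≤; <⇒≱; ≮⇒≥; n≤1+n; +-identityʳ; +-suc; m≤n⇒m<n∨m≡n; m+[n∸m]≡n; ≤⇒≤′; ≤′⇒≤; <-irrelevant)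
open import Data.Integer using (ℤ; _⊔_) renaming (_≤_ to _≤ℤ_; _<_ to _<ℤ_)
import Data.Integer as ℤ
import Data.Integer.Properties as ℤP
open import Data.Vec using (Vec; lookup)
open import Data.Fin using (fromℕ<)
open import Data.Sum using (_⊎_; inj₁; inj₂)
open import Data.Product using (_×_; _,_)
open import Data.Bool using (true; false)
open import Relation.Nullary using (yes; no)
open import Relation.Nullary.Negation using (contradiction)
open import Relation.Binary.PropositionalEquality using (_≡_; refl; trans; cong)

StrictlyDecreasingOn : ∀ {n} → Vec ℤ n → ℕ → ℕ → Set
StrictlyDecreasingOn x a b = ∀ i → a ≤ i → i < b → ent x (suc i) <ℤ ent x i

StrictlyDecreasingOn⇒antitone : ∀ {n} (x : Vec ℤ n) {a b} → StrictlyDecreasingOn x a b →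
  ∀ {i j} → a ≤ i → i ≤′ j → j ≤ b → ent x j ≤ℤ ent x i
StrictlyDecreasingOn⇒antitone x dec a≤i ≤′-refl _ = ℤP.≤-refl
StrictlyDecreasingOn⇒antitone x dec {i} {suc j} a≤i (≤′-step i≤′j) j<b =
  ℤP.≤-trans (ℤP.<⇒≤ (dec j (≤-trans a≤i (≤′⇒≤ i≤′j)) j<b))
             (StrictlyDecreasingOn⇒antitone x dec a≤i i≤′j (<⇒≤ j<b))

kFrom-≥ : ∀ {n} (x : Vec ℤ n) j fuel → j ≤ n → j ≤ kFrom x j fuel
kFrom-≥ x j zero j≤n = j≤n
kFrom-≥ {n} x j (suc fuel) j≤n with j <? n
... | no _ = j≤n
... | yes j<n with ent x j ℤ.≤? ent x (suc j)
...   | yes _ = ≤-refl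
...   | no _  = ≤-trans (n≤1+n j) (kFrom-≥ x (suc j) fuel j<n)

kFrom-strictlyDecreasing : ∀ {n} (x : Vec ℤ n) j fuel → n ≤ j + fuel →
  StrictlyDecreasingOn x j (kFrom x j fuel)
kFrom-strictlyDecreasing x j zero n≤j i j≤i i<n =
  contradiction (≤-trans n≤j (≤-trans (≤-reflexive (+-identityʳ j)) j≤i)) (<⇒≱ i<n)
kFrom-strictlyDecreasing {n} x j (suc fuel) n≤j+fuel i j≤i i<k with j <? n
... | no j≮n = contradiction (≤-trans (≮⇒≥ j≮n) j≤i) (<⇒≱ i<k)
... | yes _ with ent x j ℤ.≤? ent x (suc j)
...   | yes _ = contradiction j≤i (<⇒≱ i<k)
...   | no xj+1≰xj with m≤n⇒m<n∨m≡n j≤i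
...     | inj₁ j<i = kFrom-strictlyDecreasing x (suc j) fuel
                       (≤-trans n≤j+fuel (≤-reflexive (+-suc j fuel))) i j<i i<k
...     | inj₂ refl = ℤP.≰⇒> xj+1≰xj

1≤k : ∀ {n} (x : Vec ℤ n) → 1 ≤ n → 1 ≤ k x
1≤k {n} x = kFrom-≥ x 1 n

k-strictlyDecreasing : ∀ {n} (x : Vec ℤ n) → StrictlyDecreasingOn x 1 (k x)
k-strictlyDecreasing {n} x = kFrom-strictlyDecreasing x 1 n (n≤1+n n)

lFrom-default⊎inRange : ∀ {n} (x : Vec ℤ n) kk j fuel →
  lFrom x kk j fuel ≡ kk ∸ 1 ⊎ (j ≤ lFrom x kk j fuel × lFrom x kk j fuel < kk)
lFrom-default⊎inRange x kk j zero = inj₁ refl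
lFrom-default⊎inRange x kk j (suc fuel) with j <? kk
... | no _ = inj₁ refl
... | yes j<kk with lCond x j
...   | true = inj₂ (≤-refl , j<kk)
...   | false with lFrom-default⊎inRange x kk (suc j) fuel
...     | inj₁ default = inj₁ default
...     | inj₂ (j<l , l<kk) = inj₂ (<⇒≤ j<l , l<kk)

l+2≡k+1⊎l+2∈[3,k] : ∀ {n} (x : Vec ℤ n) → 1 ≤ n →
  suc (suc (l x)) ≡ suc (k x) ⊎ (3 ≤ suc (suc (l x)) × suc (suc (l x)) ≤ k x)
l+2≡k+1⊎l+2∈[3,k] {n} x 1≤n with lFrom-default⊎inRange x (k x) 1 n
... | inj₁ l≡k∸1 = inj₁ (cong suc (trans (cong suc l≡k∸1) (m+[n∸m]≡n (1≤k x 1≤n))))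
... | inj₂ (1≤l , l<k) with m≤n⇒m<n∨m≡n l<k
...   | inj₁ l+1<k = inj₂ (s≤s (s≤s 1≤l) , l+1<k)
...   | inj₂ l+1≡k = inj₁ (cong suc l+1≡k)

ent-suc≡lookup : ∀ {n} (x : Vec ℤ n) {i} (i<n : i < n) → ent x (suc i) ≡ lookup x (fromℕ< i<n)
ent-suc≡lookup {n} x {i} i<n with i <? n
... | yes i<n′ = cong (λ p → lookup x (fromℕ< p)) (<-irrelevant i<n′ i<n)
... | no i≮n = contradiction i<n i≮n

-- Abstracting `k x <? n` also abstracts the test hidden in `ent x (suc (k x))` on the
-- right, but not the one inside `f`, so the two copies are reconciled via `lookup`.
f-when-k<n : ∀ {n} (x : Vec ℤ n) → k x < n → f x ≡ ent x (suc (suc (l x))) ⊔ ent x (suc (k x))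
f-when-k<n {n} x k<n with k x <? n
... | yes k<n′ = cong (ent x (suc (suc (l x))) ⊔_) (ent-suc≡lookup x k<n′)
... | no k≮n = contradiction k<n k≮n

lemma3p3 : (n : ℕ) → 3 ≤ n → (x : Vec ℤ n) → k x < n →
    ent x 3 ≤ℤ ent x (suc (k x)) → f x ≡ ent x (suc (k x))
lemma3p3 n 3≤n x k<n x3≤xk+1 = trans (f-when-k<n x k<n) (ℤP.i≤j⇒i⊔j≡j xl+2≤xk+1)
  where
  1≤n : 1 ≤ n
  1≤n = ≤-trans (s≤s z≤n) 3≤n

  xl+2≤xk+1 : ent x (suc (suc (l x))) ≤ℤ ent x (suc (k x))
  xl+2≤xk+1 with l+2≡k+1⊎l+2∈[3,k] x 1≤n
  ... | inj₁ l+2≡k+1 = ℤP.≤-reflexive (cong (ent x) l+2≡k+1)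
  ... | inj₂ (3≤l+2 , l+2≤k) =
    ℤP.≤-trans (StrictlyDecreasingOn⇒antitone x (k-strictlyDecreasing x) (s≤s z≤n) (≤⇒≤′ 3≤l+2) l+2≤k)
               x3≤xk+1
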